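{- In $\mathsf{CnK}$, the strict implication $\phi\to_s\psi:=\Box(\phi\to\psi)$ is fully hyperconnexive, and the strong strict implication $\phi\Rightarrow_s\psi:=\Box((\phi\to\psi)\wedge(\sim\psi\to\sim\phi))$ is fully connexive but neither plainly nor weakly hyperconnexive.
   Context: $\mathsf{CnK}$: modal formulas are built from propositional letters with $\wedge,\vee,\to,\sim$ (strong negation), $\Box,\Diamond$. A modal Fischer-Servi model is $(W,\leq,R,V^+,V^-)$ with $W\neq\emptyset$, $\leq$ a preorder, $R\subseteq W\times W$, $V^\pm$ maps letters to $\leq$-upward closed subsets, satisfying (c1) $w\leq w'$, $wRv$ imply $w'Rv'$, $v\leq v'$ for some $v'$; (c2) $wRv$, $v\leq v'$ imply $w\leq w'$, $w'Rv'$ for some $w'$. Verification/falsification: $w\models^\pm p$ iff $w\in V^\pm(p)$; $\wedge$: $+$ iff both $+$, $-$ iff some $-$; $\vee$: $+$ iff some $+$, $-$ iff both $-$; $w\models^\pm\sim\psi$ iff $w\models^\mp\psi$; $w\models^+\psi\to\chi$ iff $\forall v\geq w(v\models^+\psi\Rightarrow v\models^+\chi)$; $w\models^-\psi\to\chi$ iff $\forall v\geq w(v\models^+\psi\Rightarrow v\models^-\chi)$; $w\models^\pm\Box\psi$ iff $\forall v\geq w\,\forall u(vRu\Rightarrow u\models^\pm\psi)$; $w\models^\pm\Diamond\psi$ iff $\exists u(wRu$ and $u\models^\pm\psi)$. $\Gamma\models_{\mathsf{CnK}}\Delta$ iff no world verifies ($\models^+$) all of $\Gamma$ and none of $\Delta$;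 $\phi\in\mathsf{CnK}$ iff $\emptyset\models\{\phi\}$. For a logic $\mathsf{L}$ and binary connective $\ast$, schemes: (AT) $\sim(\sim\phi\ast\phi)$; (BT) $(\phi\ast\sim\psi)\ast\sim(\phi\ast\psi)$; (nonSym) $(\phi\ast\psi)\ast(\psi\ast\phi)$; (WBT) $\phi\ast\sim\psi\models_\mathsf{L}\sim(\phi\ast\psi)$; (WnonSym) $\phi\ast\psi\models_\mathsf{L}\psi\ast\phi$; (CBT) $\sim(\phi\ast\psi)\ast(\phi\ast\sim\psi)$; (WCBT) $\sim(\phi\ast\psi)\models_\mathsf{L}\phi\ast\sim\psi$. $\ast$ is plainly connexive iff all AT, BT instances are valid and some nonSym instance is not; weakly connexive iff all AT, WBT instances hold and some WnonSym instance fails; fully connexive iff both. Plainly (weakly) hyperconnexive: plainly (weakly) connexive plus all CBT (WCBT) instances; fully hyperconnexive: both. -}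

module Defs where

open import Data.Nat using (ℕ)
open import Data.Product using (Σ; ∃; _×_; _,_)
open import Data.Sum using (_⊎_)
open import Data.List using (List; []; _∷_)
open import Data.List.Relation.Unary.All using (All)
open import Relation.Nullary using (¬_)

infixr 5 _⇒_
infixr 6 _∨_
infixr 7 _∧_
data Form : Set where
  var : ℕ → Form
  _∧_ _∨_ _⇒_ : Form → Form → Form
  ∼_ □_ ◇_ : Form → Form

record Model : Set₁ where
  field
    W      : Set
    w₀     : W
    _≤_    : W → W → Set
    ≤-refl  : ∀ {w} → w ≤ w
    ≤-trans : ∀ {u v w} → u ≤ v → v ≤ w → u ≤ w
    R      : W → W → Set
    V⁺ V⁻  : ℕ → W → Set
    V⁺-up  : ∀ p {w w'} → w ≤ w' → V⁺ p w → V⁺ p w'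
    V⁻-up  : ∀ p {w w'} → w ≤ w' → V⁻ p w → V⁻ p w'
    c1     : ∀ {w w' v} → w ≤ w' → R w v → Σ W (λ v' → R w' v' × v ≤ v')
    c2     : ∀ {w v v'} → R w v → v ≤ v' → Σ W (λ w' → w ≤ w' × R w' v')

open Model public

mutual
  _,_⊨⁺_ : (M : Model) → W M → Form → Set
  M , w ⊨⁺ var p = V⁺ M p w
  M , w ⊨⁺ (φ ∧ ψ) = (M , w ⊨⁺ φ) × (M , w ⊨⁺ ψ)
  M , w ⊨⁺ (φ ∨ ψ) = (M , w ⊨⁺ φ) ⊎ (M , w ⊨⁺ ψ)
  M , w ⊨⁺ (φ ⇒ ψ) = ∀ v → _≤_ M w v → M , v ⊨⁺ φ → M , v ⊨⁺ ψ
  M , w ⊨⁺ (∼ φ) = M , w ⊨⁻ φ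
  M , w ⊨⁺ (□ φ) = ∀ v → _≤_ M w v → ∀ u → R M v u → M , u ⊨⁺ φ
  M , w ⊨⁺ (◇ φ) = Σ (W M) (λ u → R M w u × M , u ⊨⁺ φ)

  _,_⊨⁻_ : (M : Model) → W M → Form → Set
  M , w ⊨⁻ var p = V⁻ M p w
  M , w ⊨⁻ (φ ∧ ψ) = (M , w ⊨⁻ φ) ⊎ (M , w ⊨⁻ ψ)
  M , w ⊨⁻ (φ ∨ ψ) = (M , w ⊨⁻ φ) × (M , w ⊨⁻ ψ)
  M , w ⊨⁻ (φ ⇒ ψ) = ∀ v → _≤_ M w v → M , v ⊨⁺ φ → M , v ⊨⁻ ψ
  M , w ⊨⁻ (∼ φ) = M , w ⊨⁺ φ
  M , w ⊨⁻ (□ φ) = ∀ v → _≤_ M w v → ∀ u → R M v u → M , u ⊨⁻ φ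
  M , w ⊨⁻ (◇ φ) = Σ (W M) (λ u → R M w u × M , u ⊨⁻ φ)

_⊨_ : List Form → List Form → Set₁
Γ ⊨ Δ = ∀ (M : Model) (w : W M) →
  ¬ (All (λ φ → M , w ⊨⁺ φ) Γ × All (λ φ → ¬ (M , w ⊨⁺ φ)) Δ)

Valid : Form → Set₁
Valid φ = [] ⊨ (φ ∷ [])

Conn : Set
Conn = Form → Form → Form

AT BT CBT WBT WCBT : Conn → Set₁
AT _*_ = ∀ φ → Valid (∼ ((∼ φ) * φ))
BT _*_ = ∀ φ ψ → Valid ((φ * (∼ ψ)) * (∼ (φ * ψ)))
CBT _*_ = ∀ φ ψ → Valid ((∼ (φ * ψ)) * (φ * (∼ ψ)))
WBT _*_ = ∀ φ ψ → ((φ * (∼ ψ)) ∷ []) ⊨ ((∼ (φ * ψ)) ∷ [])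
WCBT _*_ = ∀ φ ψ → ((∼ (φ * ψ)) ∷ []) ⊨ ((φ * (∼ ψ)) ∷ [])

NonSymFails WNonSymFails : Conn → Set₁
NonSymFails _*_ = Σ Form (λ φ → Σ Form (λ ψ → ¬ Valid ((φ * ψ) * (ψ * φ))))
WNonSymFails _*_ = Σ Form (λ φ → Σ Form (λ ψ → ¬ (((φ * ψ) ∷ []) ⊨ ((ψ * φ) ∷ []))))

PlainlyConnexive WeaklyConnexive FullyConnexive : Conn → Set₁
PlainlyConnexive c = AT c × BT c × NonSymFails c
WeaklyConnexive c = AT c × WBT c × WNonSymFails c
FullyConnexive c = PlainlyConnexive c × WeaklyConnexive c

PlainlyHyperconnexive WeaklyHyperconnexive FullyHyperconnexive : Conn → Set₁
PlainlyHyperconnexive c = PlainlyConnexive c × CBT c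
WeaklyHyperconnexive c = WeaklyConnexive c × WCBT c
FullyHyperconnexive c = PlainlyHyperconnexive c × WeaklyHyperconnexive c

_→s_ : Conn
φ →s ψ = □ (φ ⇒ ψ)

_⇒s_ : Conn
φ ⇒s ψ = □ ((φ ⇒ ψ) ∧ ((∼ ψ) ⇒ (∼ φ)))

-- Falsifying φ →s ψ is, definitionally, verifying φ →s ∼ ψ, so every instance of AT,
-- BT and CBT for →s is a strict implication between formulas verified at the same
-- worlds. For ⇒s this survives in one direction only: φ ⇒s ∼ ψ yields falsification
-- of the first conjunct of φ ⇒s ψ, but ∼ (φ ⇒s ψ) may be due to the contrapositive
-- conjunct alone, so CBT fails. All the failures are witnessed at a single reflexive
-- world where p is verified and nothing else is verified or falsified.
{-# OPTIONS --safe #-}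
module Submission where

open import Defs
open import Data.Product using (_×_; _,_; proj₁; proj₂)
open import Data.Sum using (inj₁; inj₂)
open import Data.Unit using (⊤; tt)
open import Data.Empty using (⊥)
open import Data.Nat using (ℕ; zero; suc)
open import Data.List using ([]; _∷_)
open import Data.List.Relation.Unary.All using ([]; _∷_)
open import Function using (id; _∘_)
open import Relation.Nullary using (¬_)

true⇒valid : ∀ {φ} → (∀ M w → M , w ⊨⁺ φ) → Valid φ
true⇒valid true M w (_ , not-true ∷ []) = not-true (true M w)

preserves-truth⇒entails : ∀ {φ ψ} → (∀ M w → M , w ⊨⁺ φ → M , w ⊨⁺ ψ) →
  (φ ∷ []) ⊨ (ψ ∷ [])
preserves-truth⇒entails f M w (true ∷ [] , not-true ∷ []) = not-true (f M w true)

countermodel⇒¬valid : ∀ M w {φ} → ¬ M , w ⊨⁺ φ → ¬ Valid φ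
countermodel⇒¬valid M w not-true valid = valid M w ([] , not-true ∷ [])

countermodel⇒¬entails : ∀ M w {φ ψ} → M , w ⊨⁺ φ → ¬ M , w ⊨⁺ ψ → ¬ ((φ ∷ []) ⊨ (ψ ∷ []))
countermodel⇒¬entails M w true not-true entails = entails M w (true ∷ [] , not-true ∷ [])

ReflexiveModusPonens : Conn → Set₁
ReflexiveModusPonens _*_ =
  ∀ M w φ ψ → R M w w → M , w ⊨⁺ (φ * ψ) → M , w ⊨⁺ φ → M , w ⊨⁺ ψ

module _ (_*_ : Conn) (M : Model) (w : W M) (φ ψ : Form) where

  asymmetric⇒NonSymFails : ReflexiveModusPonens _*_ → R M w w →
    M , w ⊨⁺ (φ * ψ) → ¬ M , w ⊨⁺ (ψ * φ) → NonSymFails _*_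
  asymmetric⇒NonSymFails mp loop φψ ¬ψφ =
    φ , ψ , countermodel⇒¬valid M w λ h → ¬ψφ (mp M w (φ * ψ) (ψ * φ) loop h φψ)

  asymmetric⇒WNonSymFails : M , w ⊨⁺ (φ * ψ) → ¬ M , w ⊨⁺ (ψ * φ) → WNonSymFails _*_
  asymmetric⇒WNonSymFails φψ ¬ψφ = φ , ψ , countermodel⇒¬entails M w φψ ¬ψφ

  countermodel⇒¬CBT : ReflexiveModusPonens _*_ → R M w w →
    M , w ⊨⁺ (∼ (φ * ψ)) → ¬ M , w ⊨⁺ (φ * (∼ ψ)) → ¬ CBT _*_
  countermodel⇒¬CBT mp loop neg ¬contrary cbt = countermodel⇒¬valid M w
    (λ h → ¬contrary (mp M w (∼ (φ * ψ)) (φ * (∼ ψ)) loop h neg)) (cbt φ ψ)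

  countermodel⇒¬WCBT : M , w ⊨⁺ (∼ (φ * ψ)) → ¬ M , w ⊨⁺ (φ * (∼ ψ)) → ¬ WCBT _*_
  countermodel⇒¬WCBT neg ¬contrary wcbt =
    countermodel⇒¬entails M w neg ¬contrary (wcbt φ ψ)

→s-intro : ∀ M φ ψ → (∀ {t} → M , t ⊨⁺ φ → M , t ⊨⁺ ψ) → ∀ w → M , w ⊨⁺ (φ →s ψ)
→s-intro _ _ _ f _ _ _ _ _ _ _ = f

→s-mp : ReflexiveModusPonens _→s_
→s-mp M _ _ _ loop h = h _ (≤-refl M) _ loop _ (≤-refl M)

⇒s-intro : ∀ M φ ψ → (∀ {t} → M , t ⊨⁺ φ → M , t ⊨⁺ ψ) →
  (∀ {t} → M , t ⊨⁺ (∼ ψ) → M , t ⊨⁺ (∼ φ)) → ∀ w → M , w ⊨⁺ (φ ⇒s ψ)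
⇒s-intro _ _ _ f g _ _ _ _ _ = (λ _ _ → f) , (λ _ _ → g)

⇒s-mp : ReflexiveModusPonens _⇒s_
⇒s-mp M _ _ _ loop h = proj₁ (h _ (≤-refl M) _ loop) _ (≤-refl M)

⇒s∼⇒∼⇒s : ∀ M φ ψ {w} → M , w ⊨⁺ (φ ⇒s (∼ ψ)) → M , w ⊨⁺ (∼ (φ ⇒s ψ))
⇒s∼⇒∼⇒s _ _ _ h v le u r = inj₁ (proj₁ (h v le u r))

⇒s⇒∼⇒s∼ : ∀ M φ ψ {w} → M , w ⊨⁺ (φ ⇒s ψ) → M , w ⊨⁺ (∼ (φ ⇒s (∼ ψ)))
⇒s⇒∼⇒s∼ _ _ _ h v le u r = inj₁ (proj₁ (h v le u r))

point : Model
point = record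
  { W = ⊤ ; w₀ = tt ; _≤_ = λ _ _ → ⊤ ; ≤-refl = tt ; ≤-trans = λ _ _ → tt
  ; R = λ _ _ → ⊤ ; V⁺ = only-0 ; V⁻ = λ _ _ → ⊥
  ; V⁺-up = λ _ _ → id ; V⁻-up = λ _ _ ()
  ; c1 = λ _ _ → tt , tt , tt ; c2 = λ _ _ → tt , tt , tt }
  where
  only-0 : ℕ → ⊤ → Set
  only-0 zero    _ = ⊤
  only-0 (suc _) _ = ⊥

p q : Form
p = var 0
q = var 1

→s-fullyHyperconnexive : FullyHyperconnexive _→s_
→s-fullyHyperconnexive = ((AT-holds , BT-holds , nonSym-fails) , CBT-holds)
                       , ((AT-holds , WBT-holds , wnonSym-fails) , WCBT-holds)
  where
  AT-holds : AT _→s_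
  AT-holds φ = true⇒valid λ M → →s-intro M (∼ φ) (∼ φ) id
  BT-holds : BT _→s_
  BT-holds φ ψ = true⇒valid λ M → →s-intro M (φ →s (∼ ψ)) (φ →s (∼ ψ)) id
  CBT-holds : CBT _→s_
  CBT-holds φ ψ = true⇒valid λ M → →s-intro M (φ →s (∼ ψ)) (φ →s (∼ ψ)) id
  WBT-holds : WBT _→s_
  WBT-holds φ ψ = preserves-truth⇒entails λ _ _ → id
  WCBT-holds : WCBT _→s_
  WCBT-holds φ ψ = preserves-truth⇒entails λ _ _ → id
  q→sp : point , tt ⊨⁺ (q →s p)
  q→sp = →s-intro point q p (λ ()) tt
  ¬p→sq : ¬ point , tt ⊨⁺ (p →s q)
  ¬p→sq h = →s-mp point tt p q tt h tt
  nonSym-fails : NonSymFails _→s_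
  nonSym-fails = asymmetric⇒NonSymFails _→s_ point tt q p →s-mp tt q→sp ¬p→sq
  wnonSym-fails : WNonSymFails _→s_
  wnonSym-fails = asymmetric⇒WNonSymFails _→s_ point tt q p q→sp ¬p→sq

⇒s-fullyConnexive : FullyConnexive _⇒s_
⇒s-fullyConnexive = (AT-holds , BT-holds , nonSym-fails)
                  , (AT-holds , WBT-holds , wnonSym-fails)
  where
  -- the first conjunct ∼ φ ⇒ φ of (∼ φ) ⇒s φ is falsified at every world
  AT-holds : AT _⇒s_
  AT-holds φ = true⇒valid λ _ _ _ _ _ _ → inj₁ λ _ _ → id
  BT-holds : BT _⇒s_
  BT-holds φ ψ = true⇒valid λ M →
    ⇒s-intro M (φ ⇒s (∼ ψ)) (∼ (φ ⇒s ψ)) (⇒s∼⇒∼⇒s M φ ψ) (⇒s⇒∼⇒s∼ M φ ψ)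
  WBT-holds : WBT _⇒s_
  WBT-holds φ ψ = preserves-truth⇒entails λ M _ → ⇒s∼⇒∼⇒s M φ ψ
  q⇒sp : point , tt ⊨⁺ (q ⇒s p)
  q⇒sp = ⇒s-intro point q p (λ ()) (λ ()) tt
  ¬p⇒sq : ¬ point , tt ⊨⁺ (p ⇒s q)
  ¬p⇒sq h = ⇒s-mp point tt p q tt h tt
  nonSym-fails : NonSymFails _⇒s_
  nonSym-fails = asymmetric⇒NonSymFails _⇒s_ point tt q p ⇒s-mp tt q⇒sp ¬p⇒sq
  wnonSym-fails : WNonSymFails _⇒s_
  wnonSym-fails = asymmetric⇒WNonSymFails _⇒s_ point tt q p q⇒sp ¬p⇒sq

∼p⇒sq : point , tt ⊨⁺ (∼ (p ⇒s q))
∼p⇒sq _ _ _ _ = inj₂ λ _ _ ()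

¬p⇒s∼q : ¬ point , tt ⊨⁺ (p ⇒s (∼ q))
¬p⇒s∼q h = ⇒s-mp point tt p (∼ q) tt h tt

⇒s-¬CBT : ¬ CBT _⇒s_
⇒s-¬CBT = countermodel⇒¬CBT _⇒s_ point tt p q ⇒s-mp tt ∼p⇒sq ¬p⇒s∼q

⇒s-¬WCBT : ¬ WCBT _⇒s_
⇒s-¬WCBT = countermodel⇒¬WCBT _⇒s_ point tt p q ∼p⇒sq ¬p⇒s∼q

proposition4p21 : FullyHyperconnexive _→s_ × FullyConnexive _⇒s_
    × ¬ PlainlyHyperconnexive _⇒s_ × ¬ WeaklyHyperconnexive _⇒s_
proposition4p21 =
  →s-fullyHyperconnexive , ⇒s-fullyConnexive , ⇒s-¬CBT ∘ proj₂ , ⇒s-¬WCBT ∘ proj₂
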